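{- Fix a positive integer $k$. For every tree-decomposed graph $(H,T)$ and every finite simple graph $G$, $$\hom(H,G)=\sum_{(F,T')}\mathrm{bext}\big((H,T),(F,T')\big)\cdot\mathrm{bstrhom}\big((F,T'),G\big),$$ where $(F,T')$ ranges over isomorphism types of tree-decomposed graphs and only finitely many terms are nonzero; i.e. $\hom=\mathrm{bext}\cdot\mathrm{bstrhom}$.
   Context: A tree-decomposed graph $(F,T)$ consists of a finite simple graph $F$ and a tree decomposition $T$ of $F$ of width $k$, where $T$ is a rooted tree with bags $\beta(t)\subseteq V(F)$, all bags are distinct, bags at even depth (including the root) have size $k$ and bags at odd depth have size $k+1$. An isomorphism from $(F,T)$ to $(F',T')$ is a graph isomorphism $F\to F'$ such that the induced map on bags is an isomorphism of the trees $T\to T'$. $\hom(H,G)$ is the number of homomorphisms from $H$ to $G$. $\mathrm{bstrhom}((F,T),G)$ is the number of homomorphisms $h:F\to G$ such that for every node $t$ of $T$ the restriction of $h$ to $\beta(t)$ is a strong homomorphism from $F[\beta(t)]$ to $G[h(\beta(t))]$ (i.e. additionally maps distinct non-adjacent vertices of the bag to non-adjacent vertices). A bag-wise extension of $(H,T)$ is a tree-decomposed graph $(H',T)$ with $V(H')=V(H)$, $E(H)\subseteq E(H')$, and every edge of $E(H')\setminus E(H)$ having both endpoints in a common bag of $T$; $\mathrm{bext}((H,T),(F,T'))$ is the number of bag-wise extensions of $(H,T)$ isomorphic to $(F,T')$. -}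

module Defs where

open import Data.Nat using (ℕ; zero; suc; _≤_)
open import Data.Bool using (Bool; true; false)
open import Data.Fin using (Fin)
open import Data.Fin.Subset using (Subset; _∈_; ∣_∣)
open import Data.Vec using (Vec; lookup)
open import Data.List using (List; []; _∷_; _++_; [_]; length; tabulate)
open import Data.Nat.ListAction using (sum)
open import Data.List.Membership.Propositional renaming (_∈_ to _∈ˡ_)
open import Data.List.Relation.Unary.All using (All)
open import Data.List.Relation.Unary.Unique.Propositional using (Unique)
open import Data.List.Relation.Unary.Linked using (Linked)
open import Data.Product using (Σ; ∃; _×_)
open import Relation.Nullary using (¬_)
open import Relation.Binary.PropositionalEquality using (_≡_; _≢_)
open import Function.Bundles using (_⤖_; Bijection)

record Graph : Set where
  field
    n      : ℕ
    adj    : Fin n → Fin n → Bool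
    sym    : ∀ u v → adj u v ≡ adj v u
    irrefl : ∀ u → adj u u ≡ false

data Walk {m : ℕ} (E : Fin m → Fin m → Set) : Fin m → Fin m → ℕ → Set where
  []  : ∀ {x} → Walk E x x 0
  _∷_ : ∀ {x y z d} → E x y → Walk E y z d → Walk E x z (suc d)

Edge : {m : ℕ} → (Fin m → Fin m → Bool) → Fin m → Fin m → Set
Edge a x y = a x y ≡ true

Dist : {m : ℕ} → (Fin m → Fin m → Bool) → Fin m → Fin m → ℕ → Set
Dist a x y d = Walk (Edge a) x y d × (∀ d' → Walk (Edge a) x y d' → d ≤ d')

-- a cycle: distinct vertices x, x₁, …, x_l (l ≥ 2, so ≥ 3 vertices),
-- consecutive ones adjacent and the last adjacent to x
Cycle : {m : ℕ} → (Fin m → Fin m → Bool) → Set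
Cycle {m} a = Σ (Fin m) λ x → Σ (List (Fin m)) λ xs →
  (2 ≤ length xs) × Unique (x ∷ xs) × Linked (Edge a) (x ∷ xs ++ [ x ])

record Raw : Set where
  field
    n    : ℕ
    adj  : Fin n → Fin n → Bool
    tn   : ℕ
    tadj : Fin tn → Fin tn → Bool
    root : Fin tn
    bag  : Fin tn → Subset n

sizeAt : ℕ → ℕ → ℕ
sizeAt k zero = k
sizeAt k (suc zero) = suc k
sizeAt k (suc (suc d)) = sizeAt k d

record IsTDGraph (k : ℕ) (D : Raw) : Set where
  open Raw D
  field
    sym      : ∀ u v → adj u v ≡ adj v u
    irrefl   : ∀ u → adj u u ≡ false
    tsym     : ∀ s t → tadj s t ≡ tadj t s
    tirrefl  : ∀ t → tadj t t ≡ false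
    tconn    : ∀ s t → ∃ λ d → Walk (Edge tadj) s t d
    tacyclic : ¬ Cycle tadj
    coverV   : ∀ v → ∃ λ t → v ∈ bag t
    coverE   : ∀ u v → adj u v ≡ true → ∃ λ t → (u ∈ bag t) × (v ∈ bag t)
    connV    : ∀ v s t → v ∈ bag s → v ∈ bag t →
               ∃ λ d → Walk (λ a b → Edge tadj a b × v ∈ bag a × v ∈ bag b) s t d
    distinct : ∀ s t → bag s ≡ bag t → s ≡ t
    sizes    : ∀ t d → Dist tadj root t d → ∣ bag t ∣ ≡ sizeAt k d

record TDGraph (k : ℕ) : Set where
  field
    raw   : Raw
    valid : IsTDGraph k raw
open TDGraph public

graphOf : ∀ {k} → TDGraph k → Graph
graphOf X = record
  { n = Raw.n (raw X) ; adj = Raw.adj (raw X)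
  ; sym = IsTDGraph.sym (valid X) ; irrefl = IsTDGraph.irrefl (valid X) }

-- Isomorphism of tree-decomposed graphs: a graph isomorphism π : F → F'
-- such that the induced map on bags β(t) ↦ π(β(t)) is an isomorphism of
-- the rooted trees, i.e. there is a rooted-tree isomorphism σ : T → T'
-- with β'(σ t) = π(β t) for all t.

record RawIso (D D' : Raw) : Set where
  module D = Raw D
  module D' = Raw D'
  field
    π       : Fin D.n ⤖ Fin D'.n
    σ       : Fin D.tn ⤖ Fin D'.tn
  πf = Bijection.to π
  σf = Bijection.to σ
  field
    π-adj   : ∀ u v → D'.adj (πf u) (πf v) ≡ D.adj u v
    σ-adj   : ∀ s t → D'.tadj (σf s) (σf t) ≡ D.tadj s t
    σ-root  : σf D.root ≡ D'.root
    bag-to  : ∀ t v → v ∈ D.bag t → πf v ∈ D'.bag (σf t)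
    bag-from : ∀ t v → πf v ∈ D'.bag (σf t) → v ∈ D.bag t

_≅_ : ∀ {k} → TDGraph k → TDGraph k → Set
X ≅ Y = RawIso (raw X) (raw Y)

record CountOf {A : Set} (P : A → Set) (c : ℕ) : Set where
  field
    elems    : List A
    unique   : Unique elems
    sound    : All P elems
    complete : ∀ x → P x → x ∈ˡ elems
    size     : length elems ≡ c

IsHom : (n : ℕ) → (Fin n → Fin n → Bool) → (G : Graph) → Vec (Fin (Graph.n G)) n → Set
IsHom n a G h = ∀ u v → a u v ≡ true → Graph.adj G (lookup h u) (lookup h v) ≡ true

Hom : Graph → Graph → ℕ → Set
Hom H G c = CountOf (IsHom (Graph.n H) (Graph.adj H) G) c

IsBStrHom : ∀ {k} → (X : TDGraph k) → (G : Graph) → Vec (Fin (Graph.n G)) (Raw.n (raw X)) → Set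
IsBStrHom {k} X G h = IsHom n adj G h ×
    (∀ t u v → u ∈ bag t → v ∈ bag t → u ≢ v → adj u v ≡ false →
       Graph.adj G (lookup h u) (lookup h v) ≡ false)
  where open Raw (raw X)

BStrHom : ∀ {k} → TDGraph k → Graph → ℕ → Set
BStrHom X G c = CountOf (IsBStrHom X G) c

-- Bag-wise extensions. An edge set H' on V(H) is given by its adjacency
-- matrix M; (H',T) has the same tree and bags as (H,T).

matAdj : ∀ {n} → Vec (Vec Bool n) n → Fin n → Fin n → Bool
matAdj M u v = lookup (lookup M u) v

extRaw : ∀ {k} → (X : TDGraph k) → Vec (Vec Bool (Raw.n (raw X))) (Raw.n (raw X)) → Raw
extRaw X M = record (raw X) { adj = matAdj M }

IsBExt : ∀ {k} → (H F : TDGraph k) → Vec (Vec Bool (Raw.n (raw H))) (Raw.n (raw H)) → Set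
IsBExt H F M =
    (∀ u v → matAdj M u v ≡ matAdj M v u)
  × (∀ u → matAdj M u u ≡ false)
  × (∀ u v → adj u v ≡ true → matAdj M u v ≡ true)
  × (∀ u v → matAdj M u v ≡ true → adj u v ≡ false →
       ∃ λ t → (u ∈ bag t) × (v ∈ bag t))
  × RawIso (extRaw H M) (raw F)
  where open Raw (raw H)

BExt : ∀ {k} → TDGraph k → TDGraph k → ℕ → Set
BExt H F c = CountOf (IsBExt H F) c

BExtNonzero : ∀ {k} → TDGraph k → TDGraph k → Set
BExtNonzero H F = ∃ λ c → BExt H F c × c ≢ 0

PairwiseNonIso : ∀ {k r} → (Fin r → TDGraph k) → Set
PairwiseNonIso R = ∀ i j → R i ≅ R j → i ≡ j

Covers : ∀ {k r} → TDGraph k → (Fin r → TDGraph k) → Set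
Covers {k} {r} H R = ∀ (F : TDGraph k) → BExtNonzero H F → Σ (Fin r) λ i → F ≅ R i

ΣFin : (r : ℕ) → (Fin r → ℕ) → ℕ
ΣFin r f = sum (tabulate f)

-- A homomorphism h : H → G determines a bag-wise extension H_h of (H,T): add every edge uv with
-- u, v in a common bag and h(u)h(v) ∈ E(G). Then h is a bag-wise strong homomorphism of (H_h,T),
-- and conversely, for every bag-wise extension H′, the bag-wise strong homomorphisms of (H′,T) are
-- exactly the homomorphisms h of H with H_h = H′. Counting homomorphisms by H_h, grouping the
-- extensions by isomorphism type and using that bstrhom is an isomorphism invariant gives
-- hom(H,G) = Σ bext · bstrhom. Whether an extension is isomorphic to a given (F,T′) need not be
-- decided: it is decidable up to double negation, which suffices for an equation in ℕ.
module Submission where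

open import Defs
open import Data.Nat using (ℕ; _≤_; _*_)
open import Data.Fin using (Fin)
open import Data.Product using (Σ; _×_)
open import Relation.Binary.PropositionalEquality using (_≡_)

open import Algebra.Properties.CommutativeSemigroup using (interchange)
open import Data.Bool using (Bool; true; false; _∨_)
import Data.Bool as B
open import Data.Empty using (⊥-elim)
import Data.Fin as F
open import Data.Fin.Properties using (all?; any?)
open import Data.Fin.Subset using (_∈_)
open import Data.Fin.Subset.Properties using (_∈?_)
import Data.List as List
open import Data.List using (List; []; _∷_; map; filter; length; allFin; cartesianProductWith)
open import Data.List.Membership.Propositional renaming (_∈_ to _∈ˡ_)
open import Data.List.Membership.Propositional.Properties
  using (∈-length; ∈-map⁺; ∈-filter⁺; ∈-allFin; ∈-cartesianProductWith⁺)
open import Data.List.Membership.Propositional.Properties.WithK using (unique∧set⇒bag)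
open import Data.List.Properties using (length-map; map-tabulate)
open import Data.List.Relation.Binary.BagAndSetEquality using (∼bag⇒↭)
open import Data.List.Relation.Binary.Permutation.Propositional.Properties using (↭-length)
open import Data.List.Relation.Unary.All as All using (All; []; _∷_)
open import Data.List.Relation.Unary.All.Properties
  using (all-filter) renaming (filter⁺ to all-filter⁺; map⁺ to all-map⁺)
open import Data.List.Relation.Unary.AllPairs using ([]; _∷_)
open import Data.List.Relation.Unary.Any using (here; there; index)
open import Data.List.Relation.Unary.Any.Properties using (lookup-index)
open import Data.List.Relation.Unary.Unique.Propositional using (Unique)
import Data.List.Relation.Unary.Unique.Propositional.Properties as Unique
open import Data.Nat using (zero; suc; _+_; _<_; _≟_)
open import Data.Nat.ListAction using (sum)
open import Data.Nat.Properties using (>⇒≢; *-zeroʳ; *-identityʳ; +-identityʳ; +-commutativeSemigroup)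
open import Data.Product using (∃; _,_; proj₁; proj₂)
open import Data.Vec as Vec using (Vec; lookup)
open import Data.Vec.Properties using (≡-dec; ∷-injective; lookup∘tabulate; tabulate∘lookup; tabulate-cong)
open import Function using (_∘_; id; mk⇔; _⤖_; Bijection)
open import Function.Construct.Composition using (_⤖-∘_)
open import Function.Construct.Identity using (⤖-id)
open import Function.Construct.Symmetry using (⤖-sym)
open import Relation.Binary.Definitions using (DecidableEquality)
open import Relation.Binary.PropositionalEquality
  using (refl; sym; trans; cong; cong₂; subst; subst₂; _≢_; module ≡-Reasoning)
open import Relation.Nullary using (¬_; Dec; yes; no)
open import Relation.Nullary.Decidable using (_×-dec_; _→-dec_; decidable-stable; ¬¬-excluded-middle)
open import Relation.Nullary.Negation using (¬¬-map)
open import Relation.Unary using (Decidable)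

∑ : {A : Set} → List A → (A → ℕ) → ℕ
∑ xs g = sum (map g xs)

𝟙 : {P : Set} → Dec P → ℕ
𝟙 (yes _) = 1
𝟙 (no _) = 0

𝟙-yes : {P : Set} (P? : Dec P) → P → 𝟙 P? ≡ 1
𝟙-yes (yes _) _ = refl
𝟙-yes (no ¬p) p = ⊥-elim (¬p p)

𝟙-no : {P : Set} (P? : Dec P) → ¬ P → 𝟙 P? ≡ 0
𝟙-no (yes p) ¬p = ⊥-elim (¬p p)
𝟙-no (no _)  _  = refl

module _ {A : Set} where

  ∑-cong : (xs : List A) {g h : A → ℕ} → (∀ {x} → x ∈ˡ xs → g x ≡ h x) → ∑ xs g ≡ ∑ xs h
  ∑-cong [] _ = refl
  ∑-cong (x ∷ xs) g≡h = cong₂ _+_ (g≡h (here refl)) (∑-cong xs (g≡h ∘ there))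

  ∑-const : (xs : List A) (c : ℕ) → ∑ xs (λ _ → c) ≡ length xs * c
  ∑-const [] c = refl
  ∑-const (x ∷ xs) c = cong (c +_) (∑-const xs c)

  ∑-zero : (xs : List A) {g : A → ℕ} → (∀ {x} → x ∈ˡ xs → g x ≡ 0) → ∑ xs g ≡ 0
  ∑-zero xs g≡0 = trans (∑-cong xs g≡0) (trans (∑-const xs 0) (*-zeroʳ (length xs)))

  ∑-distrib-+ : (xs : List A) (g h : A → ℕ) → ∑ xs (λ x → g x + h x) ≡ ∑ xs g + ∑ xs h
  ∑-distrib-+ [] g h = refl
  ∑-distrib-+ (x ∷ xs) g h =
    trans (cong (g x + h x +_) (∑-distrib-+ xs g h)) (interchange +-commutativeSemigroup (g x) (h x) _ _)

  ∑-single : {xs : List A} → Unique xs → {g : A → ℕ} {x₀ : A} → x₀ ∈ˡ xs →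
             (∀ {x} → x ∈ˡ xs → x ≢ x₀ → g x ≡ 0) → ∑ xs g ≡ g x₀
  ∑-single {x ∷ xs} (x∉xs ∷ _) {g} (here refl) others =
    trans (cong (g x +_) (∑-zero xs λ y∈xs → others (there y∈xs) λ { refl → All.lookup x∉xs y∈xs refl }))
          (+-identityʳ (g x))
  ∑-single {x ∷ xs} (x∉xs ∷ !xs) {g} (there x₀∈xs) others =
    cong₂ _+_ (others (here refl) λ { refl → All.lookup x∉xs x₀∈xs refl })
              (∑-single !xs x₀∈xs (others ∘ there))

  ∑-𝟙≡length-filter : {P : A → Set} (P? : Decidable P) (xs : List A) → ∑ xs (𝟙 ∘ P?) ≡ length (filter P? xs)
  ∑-𝟙≡length-filter P? [] = refl
  ∑-𝟙≡length-filter P? (x ∷ xs) with P? x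
  ... | yes _ = cong suc (∑-𝟙≡length-filter P? xs)
  ... | no _ = ∑-𝟙≡length-filter P? xs

∑-comm : {A B : Set} (xs : List A) (ys : List B) (g : A → B → ℕ) →
         ∑ xs (λ x → ∑ ys (g x)) ≡ ∑ ys (λ y → ∑ xs (λ x → g x y))
∑-comm [] ys g = sym (∑-zero ys (λ _ → refl))
∑-comm (x ∷ xs) ys g = trans (cong (∑ ys (g x) +_) (∑-comm xs ys g)) (sym (∑-distrib-+ ys (g x) _))

module _ {A : Set} {P : A → Set} where

  countOf-unique : ∀ {c d} → CountOf P c → CountOf P d → c ≡ d
  countOf-unique {c} {d} C D = begin
    c                 ≡⟨ sym C.size ⟩
    length C.elems    ≡⟨ ↭-length (∼bag⇒↭ (unique∧set⇒bag C.unique D.unique (mk⇔ (move C D) (move D C)))) ⟩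
    length D.elems    ≡⟨ D.size ⟩
    d                 ∎
    where
    open ≡-Reasoning
    module C = CountOf C
    module D = CountOf D
    move : ∀ {c′ d′} (X : CountOf P c′) (Y : CountOf P d′) {x} → x ∈ˡ CountOf.elems X → x ∈ˡ CountOf.elems Y
    move X Y x∈X = CountOf.complete Y _ (All.lookup (CountOf.sound X) x∈X)

  countOf-restrict : ∀ {c} {Q : A → Set} (Q? : Decidable Q) (C : CountOf P c) →
                     CountOf (λ x → P x × Q x) (length (filter Q? (CountOf.elems C)))
  countOf-restrict Q? C = record
    { elems    = filter Q? elems
    ; unique   = Unique.filter⁺ Q? unique
    ; sound    = All.zip (all-filter⁺ Q? sound , all-filter Q? elems)
    ; complete = λ x (Px , Qx) → ∈-filter⁺ Q? (complete x Px) Qx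
    ; size     = refl
    }
    where open CountOf C

  countOf-nonzero : ∀ {c} → CountOf P c → ∀ x → P x → c ≢ 0
  countOf-nonzero C _ Px = >⇒≢ (subst (0 <_) (CountOf.size C) (∈-length (CountOf.complete C _ Px)))

  countOf-witness : ∀ {c} → CountOf P c → c ≢ 0 → ∃ P
  countOf-witness C c≢0 with CountOf.elems C | CountOf.sound C | CountOf.size C
  ... | []    | _        | refl = ⊥-elim (c≢0 refl)
  ... | x ∷ _ | Px ∷ _   | _    = x , Px

countOf-transport : {A B : Set} {P : A → Set} {Q : B → Set} (f : A → B) (g : B → A) →
                    (∀ x → g (f x) ≡ x) → (∀ y → f (g y) ≡ y) →
                    (∀ {x} → P x → Q (f x)) → (∀ {y} → Q y → P (g y)) →
                    ∀ {c} → CountOf Q c → CountOf P c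
countOf-transport f g g∘f f∘g P⇒Q Q⇒P C = record
  { elems    = map g elems
  ; unique   = Unique.map⁺ g-injective unique
  ; sound    = all-map⁺ (All.map Q⇒P sound)
  ; complete = λ x Px → subst (_∈ˡ map g elems) (g∘f x) (∈-map⁺ g (complete (f x) (P⇒Q Px)))
  ; size     = trans (length-map g elems) size
  }
  where
  open CountOf C
  g-injective : ∀ {y y′} → g y ≡ g y′ → y ≡ y′
  g-injective {y} {y′} e = trans (sym (f∘g y)) (trans (cong f e) (f∘g y′))

module _ {A B I : Set} (_≟B_ : DecidableEquality B) {P : A → Set} (f : A → B)
         {is : List I} (E : I → List B) (s : I → ℕ) where

  count-by-classes :
      Unique is → (∀ i → Unique (E i)) → (∀ {i j y} → y ∈ˡ E i → y ∈ˡ E j → i ≡ j)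
    → (∀ {x} → P x → Σ I λ i → i ∈ˡ is × f x ∈ˡ E i)
    → (∀ {i y} → y ∈ˡ E i → CountOf (λ x → P x × f x ≡ y) (s i))
    → ∀ {c} → CountOf P c → c ≡ ∑ is (λ i → length (E i) * s i)
  count-by-classes !is !E disjoint classify fibre {c} C = begin
    c                                              ≡⟨ sym size ⟩
    length elems                                   ≡⟨ sym (trans (∑-const elems 1) (*-identityʳ _)) ⟩
    ∑ elems (λ _ → 1)                              ≡⟨ ∑-cong elems (sym ∘ one-class ∘ All.lookup sound) ⟩
    ∑ elems (λ x → ∑ is λ i → ∑ (E i) (δ x))       ≡⟨ ∑-comm elems is _ ⟩
    ∑ is (λ i → ∑ elems λ x → ∑ (E i) (δ x))       ≡⟨ ∑-cong is (λ {i} _ → ∑-comm elems (E i) δ) ⟩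
    ∑ is (λ i → ∑ (E i) λ y → ∑ elems λ x → δ x y) ≡⟨ ∑-cong is (λ {i} _ → ∑-cong (E i) fibre-size) ⟩
    ∑ is (λ i → ∑ (E i) λ _ → s i)                 ≡⟨ ∑-cong is (λ {i} _ → ∑-const (E i) (s i)) ⟩
    ∑ is (λ i → length (E i) * s i)                ∎
    where
    open ≡-Reasoning
    open CountOf C
    δ : A → B → ℕ
    δ x y = 𝟙 (f x ≟B y)
    one-class : ∀ {x} → P x → ∑ is (λ i → ∑ (E i) (δ x)) ≡ 1
    one-class {x} Px with classify Px
    ... | i₀ , i₀∈is , fx∈E = trans (∑-single !is i₀∈is other-class) (trans (∑-single (!E i₀) fx∈E other-y) δ-fx)
      where
      other-class : ∀ {i} → i ∈ˡ is → i ≢ i₀ → ∑ (E i) (δ x) ≡ 0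
      other-class {i} _ i≢i₀ = ∑-zero (E i) λ y∈E → 𝟙-no (f x ≟B _) λ { refl → i≢i₀ (disjoint y∈E fx∈E) }
      other-y : ∀ {y} → y ∈ˡ E i₀ → y ≢ f x → δ x y ≡ 0
      other-y _ y≢fx = 𝟙-no (f x ≟B _) (y≢fx ∘ sym)
      δ-fx : δ x (f x) ≡ 1
      δ-fx = 𝟙-yes (f x ≟B f x) refl
    fibre-size : ∀ {i y} → y ∈ˡ E i → ∑ elems (λ x → δ x y) ≡ s i
    fibre-size {y = y} y∈E = trans (∑-𝟙≡length-filter (λ x → f x ≟B y) elems)
                                   (countOf-unique (countOf-restrict (λ x → f x ≟B y) C) (fibre y∈E))

record Enumeration (A : Set) : Set where
  field
    elements : List A
    unique   : Unique elements
    complete : ∀ x → x ∈ˡ elements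

module _ {A : Set} (E : Enumeration A) where
  open Enumeration E

  countOf-decidable : {Q : A → Set} (Q? : Decidable Q) → CountOf Q (length (filter Q? elements))
  countOf-decidable Q? = record
    { elems    = filter Q? elements
    ; unique   = Unique.filter⁺ Q? unique
    ; sound    = all-filter Q? elements
    ; complete = λ x → ∈-filter⁺ Q? (complete x)
    ; size     = refl
    }

  ¬¬-∀ : {Q : A → Set} → (∀ x → ¬ ¬ Q x) → ¬ ¬ (∀ x → Q x)
  ¬¬-∀ {Q} ¬¬Q = ¬¬-map (λ Qs x → All.lookup Qs (complete x)) (¬¬-All elements)
    where
    ¬¬-All : ∀ xs → ¬ ¬ All Q xs
    ¬¬-All []       k = k []
    ¬¬-All (x ∷ xs) k = ¬¬Q x λ Qx → ¬¬-All xs λ Qxs → k (Qx ∷ Qxs)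

enumerateBool : Enumeration Bool
enumerateBool = record
  { elements = true ∷ false ∷ []
  ; unique   = ((λ ()) ∷ []) ∷ [] ∷ []
  ; complete = λ { true → here refl ; false → there (here refl) }
  }

enumerateVec : {A : Set} → Enumeration A → ∀ n → Enumeration (Vec A n)
enumerateVec E zero = record
  { elements = Vec.[] ∷ [] ; unique = [] ∷ [] ; complete = λ { Vec.[] → here refl } }
enumerateVec E (suc n) = record
  { elements = cartesianProductWith Vec._∷_ A.elements V.elements
  ; unique   = Unique.cartesianProductWith⁺ Vec._∷_ ∷-injective A.unique V.unique
  ; complete = λ { (x Vec.∷ xs) → ∈-cartesianProductWith⁺ Vec._∷_ (A.complete x) (V.complete xs) }
  }
  where
  module A = Enumeration E
  module V = Enumeration (enumerateVec E n)

module _ {A B : Set} (f : A ⤖ B) where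
  open Bijection f

  to∘to⁻ : ∀ y → to (to⁻ y) ≡ y
  to∘to⁻ y = proj₂ (strictlySurjective y)

  to⁻∘to : ∀ x → to⁻ (to x) ≡ x
  to⁻∘to x = injective (to∘to⁻ (to x))

module _ {D D′ : Raw} (I : RawIso D D′) where
  open RawIso I
  open Raw

  rawIso-sym : RawIso D′ D
  rawIso-sym = record
    { π        = ⤖-sym π
    ; σ        = ⤖-sym σ
    ; π-adj    = λ u v → trans (sym (π-adj (π⁻ u) (π⁻ v))) (cong₂ (adj D′) (to∘to⁻ π u) (to∘to⁻ π v))
    ; σ-adj    = λ s t → trans (sym (σ-adj (σ⁻ s) (σ⁻ t))) (cong₂ (tadj D′) (to∘to⁻ σ s) (to∘to⁻ σ t))
    ; σ-root   = trans (cong σ⁻ (sym σ-root)) (to⁻∘to σ (root D))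
    ; bag-to   = λ t v v∈ → bag-from (σ⁻ t) (π⁻ v) (subst₂ In (sym (to∘to⁻ π v)) (sym (to∘to⁻ σ t)) v∈)
    ; bag-from = λ t v v∈ → subst₂ In (to∘to⁻ π v) (to∘to⁻ σ t) (bag-to (σ⁻ t) (π⁻ v) v∈)
    }
    where
    π⁻ = Bijection.to⁻ π
    σ⁻ = Bijection.to⁻ σ
    In : Fin (n D′) → Fin (tn D′) → Set
    In v t = v ∈ bag D′ t

rawIso-refl : (D : Raw) → RawIso D D
rawIso-refl D = record
  { π = ⤖-id _ ; σ = ⤖-id _
  ; π-adj = λ _ _ → refl ; σ-adj = λ _ _ → refl ; σ-root = refl
  ; bag-to = λ _ _ v∈ → v∈ ; bag-from = λ _ _ v∈ → v∈
  }

rawIso-trans : {D D′ D″ : Raw} → RawIso D D′ → RawIso D′ D″ → RawIso D D″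
rawIso-trans I J = record
  { π        = J.π ⤖-∘ I.π
  ; σ        = J.σ ⤖-∘ I.σ
  ; π-adj    = λ u v → trans (J.π-adj _ _) (I.π-adj u v)
  ; σ-adj    = λ s t → trans (J.σ-adj _ _) (I.σ-adj s t)
  ; σ-root   = trans (cong J.σf I.σ-root) J.σ-root
  ; bag-to   = λ t v v∈ → J.bag-to _ _ (I.bag-to t v v∈)
  ; bag-from = λ t v v∈ → I.bag-from t v (J.bag-from _ _ v∈)
  }
  where
  module I = RawIso I
  module J = RawIso J

lookup-ext : {A : Set} {n : ℕ} {xs ys : Vec A n} → (∀ i → lookup xs i ≡ lookup ys i) → xs ≡ ys
lookup-ext {xs = xs} {ys} eq = trans (sym (tabulate∘lookup xs)) (trans (tabulate-cong eq) (tabulate∘lookup ys))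

-- IsBStrHom X G unfolds to IsBagStrongHom (raw X) G; the Raw form also applies to extRaw H M.
IsBagStrongHom : (D : Raw) (G : Graph) → Vec (Fin (Graph.n G)) (Raw.n D) → Set
IsBagStrongHom D G h = IsHom n adj G h ×
    (∀ t u v → u ∈ bag t → v ∈ bag t → u ≢ v → adj u v ≡ false →
       Graph.adj G (lookup h u) (lookup h v) ≡ false)
  where open Raw D

module _ (G : Graph) where
  open Graph G using () renaming (n to m)

  pull : {D D′ : Raw} → RawIso D D′ → Vec (Fin m) (Raw.n D′) → Vec (Fin m) (Raw.n D)
  pull I h = Vec.tabulate (lookup h ∘ RawIso.πf I)

  lookup-pull : {D D′ : Raw} (I : RawIso D D′) (h : Vec (Fin m) (Raw.n D′)) →
                ∀ u → lookup (pull I h) u ≡ lookup h (RawIso.πf I u)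
  lookup-pull I h = lookup∘tabulate (lookup h ∘ RawIso.πf I)

  module _ {D D′ : Raw} (I : RawIso D D′) where
    open RawIso I

    pull-isBagStrongHom : ∀ {h} → IsBagStrongHom D′ G h → IsBagStrongHom D G (pull I h)
    pull-isBagStrongHom {h} (hom , strong) = hom′ , strong′
      where
      hom′ : IsHom (Raw.n D) (Raw.adj D) G (pull I h)
      hom′ u v uv rewrite lookup-pull I h u | lookup-pull I h v = hom (πf u) (πf v) (trans (π-adj u v) uv)
      strong′ : ∀ t u v → u ∈ Raw.bag D t → v ∈ Raw.bag D t → u ≢ v → Raw.adj D u v ≡ false →
                Graph.adj G (lookup (pull I h) u) (lookup (pull I h) v) ≡ false
      strong′ t u v u∈ v∈ u≢v uv rewrite lookup-pull I h u | lookup-pull I h v =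
        strong (σf t) (πf u) (πf v) (bag-to t u u∈) (bag-to t v v∈)
               (u≢v ∘ Bijection.injective π) (trans (π-adj u v) uv)

    pull-sym-pull : ∀ h → pull (rawIso-sym I) (pull I h) ≡ h
    pull-sym-pull h = lookup-ext λ u →
      trans (lookup-pull (rawIso-sym I) (pull I h) u)
            (trans (lookup-pull I h (Bijection.to⁻ π u)) (cong (lookup h) (to∘to⁻ π u)))

    pull-pull-sym : ∀ h → pull I (pull (rawIso-sym I) h) ≡ h
    pull-pull-sym h = lookup-ext λ u →
      trans (lookup-pull I (pull (rawIso-sym I) h) u)
            (trans (lookup-pull (rawIso-sym I) h (πf u)) (cong (lookup h) (to⁻∘to π u)))

  countOf-bagStrongHom-invariant : {D D′ : Raw} → RawIso D D′ → ∀ {c} →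
    CountOf (IsBagStrongHom D′ G) c → CountOf (IsBagStrongHom D G) c
  countOf-bagStrongHom-invariant I = countOf-transport (pull (rawIso-sym I)) (pull I)
    (pull-pull-sym I) (pull-sym-pull I)
    (λ {h} → pull-isBagStrongHom (rawIso-sym I) {h}) (λ {h} → pull-isBagStrongHom I {h})

inducedEdge : Bool → {X : Set} → Dec X → Bool → Bool
inducedEdge a (yes _) g = a ∨ g
inducedEdge a (no _)  g = a

module _ {X : Set} where

  inducedEdge-old : ∀ {a} (x? : Dec X) g → a ≡ true → inducedEdge a x? g ≡ true
  inducedEdge-old (yes _) g refl = refl
  inducedEdge-old (no _)  g refl = refl

  inducedEdge-new : ∀ {a} (x? : Dec X) g → inducedEdge a x? g ≡ true → a ≡ false → X × g ≡ true
  inducedEdge-new (yes x) g e refl = x , e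
  inducedEdge-new (no _)  g () refl

  inducedEdge-true : ∀ a (x? : Dec X) {g} → X → g ≡ true → inducedEdge a x? g ≡ true
  inducedEdge-true false (yes _) _ refl = refl
  inducedEdge-true true  (yes _) _ refl = refl
  inducedEdge-true a     (no ¬x) x _    = ⊥-elim (¬x x)

  inducedEdge-false : ∀ {a} (x? : Dec X) {g} → a ≡ false → (X → g ≡ false) → inducedEdge a x? g ≡ false
  inducedEdge-false (yes x) refl g≡false = g≡false x
  inducedEdge-false (no _)  refl _       = refl

  inducedEdge-absent : ∀ a (x? : Dec X) g → inducedEdge a x? g ≡ false → X → g ≡ false
  inducedEdge-absent false (yes _) false _ _ = refl
  inducedEdge-absent a     (no ¬x) g     _ x = ⊥-elim (¬x x)
  inducedEdge-absent true  (yes _) g     () _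
  inducedEdge-absent false (yes _) true  () _

module Extensions {k : ℕ} (H : TDGraph k) where
  open Raw (raw H)
  module VH = IsTDGraph (valid H)

  Matrix : Set
  Matrix = Vec (Vec Bool n) n

  matrices : Enumeration Matrix
  matrices = enumerateVec (enumerateVec enumerateBool n) n

  SharesBag : Fin n → Fin n → Set
  SharesBag u v = ∃ λ t → u ∈ bag t × v ∈ bag t

  sharesBag? : ∀ u v → Dec (SharesBag u v)
  sharesBag? u v = any? λ t → (u ∈? bag t) ×-dec (v ∈? bag t)

  sharesBag-sym : ∀ {u v} → SharesBag u v → SharesBag v u
  sharesBag-sym (t , u∈ , v∈) = t , v∈ , u∈

  IsBagwiseExtension : Matrix → Set
  IsBagwiseExtension M =
      (∀ u v → matAdj M u v ≡ matAdj M v u)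
    × (∀ u → matAdj M u u ≡ false)
    × (∀ u v → adj u v ≡ true → matAdj M u v ≡ true)
    × (∀ u v → matAdj M u v ≡ true → adj u v ≡ false → SharesBag u v)

  isBagwiseExtension? : Decidable IsBagwiseExtension
  isBagwiseExtension? M =
          all? (λ u → all? λ v → matAdj M u v B.≟ matAdj M v u)
    ×-dec all? (λ u → matAdj M u u B.≟ false)
    ×-dec all? (λ u → all? λ v → (adj u v B.≟ true) →-dec (matAdj M u v B.≟ true))
    ×-dec all? (λ u → all? λ v → (matAdj M u v B.≟ true) →-dec ((adj u v B.≟ false) →-dec sharesBag? u v))

  isBExt⁺ : ∀ F M → IsBagwiseExtension M → RawIso (extRaw H M) (raw F) → IsBExt H F M
  isBExt⁺ F M (sym , irrefl , ⊇adj , new) I = sym , irrefl , ⊇adj , new , I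

  isBExt⁻ : ∀ F M → IsBExt H F M → IsBagwiseExtension M × RawIso (extRaw H M) (raw F)
  isBExt⁻ F M (sym , irrefl , ⊇adj , new , I) = (sym , irrefl , ⊇adj , new) , I

  extension-isTDGraph : ∀ {M} → IsBagwiseExtension M → IsTDGraph k (extRaw H M)
  extension-isTDGraph {M} (sym , irrefl , ⊇adj , new) = record
    { sym = sym ; irrefl = irrefl
    ; tsym = VH.tsym ; tirrefl = VH.tirrefl ; tconn = VH.tconn ; tacyclic = VH.tacyclic
    ; coverV = VH.coverV ; coverE = coverE ; connV = VH.connV
    ; distinct = VH.distinct ; sizes = VH.sizes
    }
    where
    coverE : ∀ u v → matAdj M u v ≡ true → SharesBag u v
    coverE u v uv with adj u v in eq
    ... | true  = VH.coverE u v eq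
    ... | false = new u v uv eq

  -- H is a junk value for matrices that are not bag-wise extensions.
  extension : Matrix → TDGraph k
  extension M with isBagwiseExtension? M
  ... | yes ext = record { raw = extRaw H M ; valid = extension-isTDGraph {M} ext }
  ... | no _    = H

  extension-≅ : ∀ M → IsBagwiseExtension M → RawIso (extRaw H M) (raw (extension M))
  extension-≅ M ext with isBagwiseExtension? M
  ... | yes _   = rawIso-refl _
  ... | no ¬ext = ⊥-elim (¬ext ext)

  module _ (G : Graph) where
    open Graph G using () renaming (adj to adjG; irrefl to irreflG; sym to symG)

    inducedAdj : Vec (Fin (Graph.n G)) n → Fin n → Fin n → Bool
    inducedAdj h u v = inducedEdge (adj u v) (sharesBag? u v) (adjG (lookup h u) (lookup h v))

    induced : Vec (Fin (Graph.n G)) n → Matrix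
    induced h = Vec.tabulate λ u → Vec.tabulate (inducedAdj h u)

    module _ (h : Vec (Fin (Graph.n G)) n) where

      induced-adj : ∀ u v → matAdj (induced h) u v ≡ inducedAdj h u v
      induced-adj u v = trans (cong (λ row → lookup row v) (lookup∘tabulate _ u)) (lookup∘tabulate _ v)

      induced-isBagwiseExtension : IsBagwiseExtension (induced h)
      induced-isBagwiseExtension = symmetric , irreflexive , ⊇adj , new
        where
        symmetric : ∀ u v → matAdj (induced h) u v ≡ matAdj (induced h) v u
        symmetric u v =
          trans (induced-adj u v) (trans (edge-sym (sharesBag? u v) (sharesBag? v u)) (sym (induced-adj v u)))
          where
          edge-sym : ∀ (uv? : Dec (SharesBag u v)) (vu? : Dec (SharesBag v u)) →
                     inducedEdge (adj u v) uv? (adjG (lookup h u) (lookup h v))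
                     ≡ inducedEdge (adj v u) vu? (adjG (lookup h v) (lookup h u))
          edge-sym (yes _)  (yes _)  = cong₂ _∨_ (VH.sym u v) (symG _ _)
          edge-sym (no _)   (no _)   = VH.sym u v
          edge-sym (yes uv) (no ¬vu) = ⊥-elim (¬vu (sharesBag-sym uv))
          edge-sym (no ¬uv) (yes vu) = ⊥-elim (¬uv (sharesBag-sym vu))
        irreflexive : ∀ u → matAdj (induced h) u u ≡ false
        irreflexive u = trans (induced-adj u u) (inducedEdge-false (sharesBag? u u) (VH.irrefl u) λ _ → irreflG _)
        ⊇adj : ∀ u v → adj u v ≡ true → matAdj (induced h) u v ≡ true
        ⊇adj u v uv = trans (induced-adj u v) (inducedEdge-old (sharesBag? u v) _ uv)
        new : ∀ u v → matAdj (induced h) u v ≡ true → adj u v ≡ false → SharesBag u v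
        new u v uv ¬uv = proj₁ (inducedEdge-new (sharesBag? u v) _ (trans (sym (induced-adj u v)) uv) ¬uv)

      induced-isBagStrongHom : IsHom n adj G h → IsBagStrongHom (extRaw H (induced h)) G h
      induced-isBagStrongHom hom = hom′ , strong
        where
        hom′ : ∀ u v → matAdj (induced h) u v ≡ true → adjG (lookup h u) (lookup h v) ≡ true
        hom′ u v uv with adj u v in eq
        ... | true  = hom u v eq
        ... | false = proj₂ (inducedEdge-new (sharesBag? u v) _ (trans (sym (induced-adj u v)) uv) eq)
        strong : ∀ t u v → u ∈ bag t → v ∈ bag t → u ≢ v → matAdj (induced h) u v ≡ false →
                 adjG (lookup h u) (lookup h v) ≡ false
        strong t u v u∈ v∈ _ ¬uv =
          inducedEdge-absent (adj u v) (sharesBag? u v) _ (trans (sym (induced-adj u v)) ¬uv) (t , u∈ , v∈)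

      module _ {M : Matrix} (ext : IsBagwiseExtension M) (bsh : IsBagStrongHom (extRaw H M) G h) where
        private
          ⊇adj = proj₁ (proj₂ (proj₂ ext))
          new  = proj₂ (proj₂ (proj₂ ext))

        isBagStrongHom⇒isHom : IsHom n adj G h
        isBagStrongHom⇒isHom u v uv = proj₁ bsh u v (⊇adj u v uv)

        isBagStrongHom⇒induced : induced h ≡ M
        isBagStrongHom⇒induced = lookup-ext λ u → lookup-ext λ v → trans (induced-adj u v) (edge u v)
          where
          edge : ∀ u v → inducedAdj h u v ≡ matAdj M u v
          edge u v with matAdj M u v in eM | adj u v in eH
          ... | true  | true  = inducedEdge-old (sharesBag? u v) _ refl
          ... | false | true  with () ← trans (sym eM) (⊇adj u v eH)
          ... | true  | false = inducedEdge-true false (sharesBag? u v) (new u v eM eH) (proj₁ bsh u v eM)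
          ... | false | false = inducedEdge-false (sharesBag? u v) refl strong
            where
            strong : SharesBag u v → adjG (lookup h u) (lookup h v) ≡ false
            strong (t , u∈ , v∈) with u F.≟ v
            ... | yes refl = irreflG _
            ... | no u≢v   = proj₂ bsh t u v u∈ v∈ u≢v eM

    countOf-fibre : ∀ M {c} → IsBagwiseExtension M → CountOf (IsBagStrongHom (extRaw H M) G) c →
                    CountOf (λ h → IsHom n adj G h × induced h ≡ M) c
    countOf-fibre M ext = countOf-transport id id (λ _ → refl) (λ _ → refl)
      (λ {h} (hom , eq) → subst (λ M → IsBagStrongHom (extRaw H M) G h) eq (induced-isBagStrongHom h hom))
      (λ {h} bsh → isBagStrongHom⇒isHom h {M} ext bsh , isBagStrongHom⇒induced h {M} ext bsh)

module _ {k : ℕ} (H : TDGraph k) where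
  open Extensions H
  open Raw (raw H) using (n; adj)

  representatives : Σ ℕ λ r → Σ (Fin r → TDGraph k) λ R → Covers H R
  representatives = length mats , extension ∘ List.lookup mats , covers
    where
    mats = Enumeration.elements matrices
    covers : Covers H (extension ∘ List.lookup mats)
    covers F (c , C , c≢0) with countOf-witness C c≢0
    ... | M , bext with isBExt⁻ F M bext
    ... | ext , I =
      index M∈mats ,
      subst (λ M′ → F ≅ extension M′) (lookup-index M∈mats) (rawIso-trans (rawIso-sym I) (extension-≅ M ext))
      where
      M∈mats = Enumeration.complete matrices M

  ¬¬-decide-BExt : ¬ ¬ (∀ M M′ → Dec (IsBExt H (extension M) M′))
  ¬¬-decide-BExt = ¬¬-∀ matrices λ M → ¬¬-∀ matrices λ M′ → ¬¬-excluded-middle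

  module _ (G : Graph) {r : ℕ} (R : Fin r → TDGraph k) (pni : PairwiseNonIso R) (cov : Covers H R)
           {b s : Fin r → ℕ} (BE : ∀ i → BExt H (R i) (b i)) (SC : ∀ i → BStrHom (R i) G (s i)) where

    E : Fin r → List Matrix
    E i = CountOf.elems (BE i)

    bext-of : ∀ {i M} → M ∈ˡ E i → IsBagwiseExtension M × RawIso (extRaw H M) (raw (R i))
    bext-of {i} {M} M∈E = isBExt⁻ (R i) M (All.lookup (CountOf.sound (BE i)) M∈E)

    classes-disjoint : ∀ {i j M} → M ∈ˡ E i → M ∈ˡ E j → i ≡ j
    classes-disjoint M∈Ei M∈Ej = pni _ _ (rawIso-trans (rawIso-sym (proj₂ (bext-of M∈Ei))) (proj₂ (bext-of M∈Ej)))

    classify : (∀ M M′ → Dec (IsBExt H (extension M) M′)) →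
               ∀ M → IsBagwiseExtension M → Σ (Fin r) λ i → M ∈ˡ E i
    classify dec M ext = i , CountOf.complete (BE i) M (isBExt⁺ (R i) M ext (rawIso-trans (extension-≅ M ext) M≅Ri))
      where
      self-count = countOf-decidable matrices (dec M)
      self = isBExt⁺ (extension M) M ext (extension-≅ M ext)
      class = cov (extension M) (_ , self-count , countOf-nonzero self-count M self)
      i = proj₁ class
      M≅Ri = proj₂ class

    fibre : ∀ {i M} → M ∈ˡ E i → CountOf (λ h → IsHom n adj G h × induced G h ≡ M) (s i)
    fibre {i} {M} M∈E with bext-of M∈E
    ... | ext , M≅Ri = countOf-fibre G M ext (countOf-bagStrongHom-invariant G M≅Ri (SC i))

    hom≡Σbext*bstrhom : (∀ M M′ → Dec (IsBExt H (extension M) M′)) →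
                        ∀ {hm} → Hom (graphOf H) G hm → hm ≡ ΣFin r (λ i → b i * s i)
    hom≡Σbext*bstrhom dec {hm} HC = begin
      hm                                      ≡⟨ by-classes ⟩
      ∑ (allFin r) (λ i → length (E i) * s i) ≡⟨ ∑-cong (allFin r) (λ {i} _ → cong (_* s i) (CountOf.size (BE i))) ⟩
      ∑ (allFin r) (λ i → b i * s i)          ≡⟨ cong sum (map-tabulate id (λ i → b i * s i)) ⟩
      ΣFin r (λ i → b i * s i)                ∎
      where
      open ≡-Reasoning
      _≟M_ : DecidableEquality Matrix
      _≟M_ = ≡-dec (≡-dec B._≟_)
      class-of : ∀ {h} → IsHom n adj G h → Σ (Fin r) λ i → i ∈ˡ allFin r × induced G h ∈ˡ E i
      class-of {h} _ with classify dec (induced G h) (induced-isBagwiseExtension G h)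
      ... | i , M∈E = i , ∈-allFin i , M∈E
      by-classes : hm ≡ ∑ (allFin r) (λ i → length (E i) * s i)
      by-classes = count-by-classes _≟M_ {P = IsHom n adj G} (induced G) E s (Unique.allFin⁺ r)
                     (λ i → CountOf.unique (BE i)) classes-disjoint (λ {h} → class-of {h}) fibre HC

mainTheorem11 : (k : ℕ) → 1 ≤ k → (H : TDGraph k) → (G : Graph) →
    (Σ ℕ λ r → Σ (Fin r → TDGraph k) λ R → Covers H R)
    × (∀ r (R : Fin r → TDGraph k) → PairwiseNonIso R → Covers H R →
        ∀ (hm : ℕ) → Hom (graphOf H) G hm →
        ∀ (b s : Fin r → ℕ) → (∀ i → BExt H (R i) (b i)) → (∀ i → BStrHom (R i) G (s i)) →
        hm ≡ ΣFin r (λ i → b i * s i))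
-- The identity holds for every k.
mainTheorem11 k _ H G = representatives H , λ r R pni cov hm HC b s BE SC →
  decidable-stable (hm ≟ ΣFin r (λ i → b i * s i))
    (¬¬-map (λ dec → hom≡Σbext*bstrhom H G R pni cov BE SC dec HC) (¬¬-decide-BExt H))
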